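{- Let $\mathcal{A}_0\subset\{0,1\}^n$ be the initially infected set. The $3$-neighbor bootstrap percolation process on $Q_{n,2}$ started from $\mathcal{A}_0$ percolates if and only if there exist (distinct) vertices $x_1,x_2,x_3\in\mathcal{A}_0$ whose pairwise Hamming distances are all at most $4$.
   Context: $Q_{n,2}$ is the graph with vertex set $\{0,1\}^n$ in which $x,y$ are adjacent iff $1\le d_H(x,y)\le 2$ ($d_H$ = Hamming distance). The $r$-neighbor bootstrap percolation process from $\mathcal{A}_0\subset V$: $\mathcal{A}_i=\mathcal{A}_{i-1}\cup\{v: |N_v\cap\mathcal{A}_{i-1}|\ge r\}$, where $N_v$ is the neighborhood of $v$; it percolates if $\mathcal{A}_i=V$ for some $i$. -}

module Defs where

open import Data.Nat using (ℕ; zero; suc; _+_; _≤_; _≤ᵇ_)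
open import Data.Bool using (Bool; true; false; _∧_; _∨_; if_then_else_)
open import Data.Vec using (Vec; []; _∷_)
open import Data.List using (List; []; _∷_; map; _++_; filter; length)
open import Relation.Nullary.Decidable using (Dec; yes; no)
open import Data.Bool using (T)
open import Data.Bool.Properties using (T?)
open import Data.Product using (Σ)
open import Relation.Binary.PropositionalEquality using (_≡_)

Vertex : ℕ → Set
Vertex n = Vec Bool n

xorB : Bool → Bool → Bool
xorB true  true  = false
xorB false false = false
xorB _     _     = true

dH : ∀ {n} → Vertex n → Vertex n → ℕ
dH []       []       = 0
dH (a ∷ x)  (b ∷ y)  = (if xorB a b then 1 else 0) + dH x y

allVertices : (n : ℕ) → List (Vertex n)
allVertices zero    = [] ∷ []
allVertices (suc n) = map (false ∷_) (allVertices n) ++ map (true ∷_) (allVertices n)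

adjB : ∀ {n} → Vertex n → Vertex n → Bool
adjB x y = (1 ≤ᵇ dH x y) ∧ (dH x y ≤ᵇ 2)

VSet : ℕ → Set
VSet n = Vertex n → Bool

nbCount : ∀ {n} → VSet n → Vertex n → ℕ
nbCount {n} A v = length (filter (λ u → T? (adjB v u ∧ A u)) (allVertices n))

step : ∀ {n} → ℕ → VSet n → VSet n
step r A v = A v ∨ (r ≤ᵇ nbCount A v)

infected : ∀ {n} → ℕ → VSet n → ℕ → VSet n
infected r A zero    = A
infected r A (suc i) = step r (infected r A i)

Percolates : ∀ {n} → ℕ → VSet n → Set
Percolates {n} r A = Σ ℕ (λ i → (v : Vertex n) → infected r A i v ≡ true)

{-# OPTIONS --safe #-}
module Submission where

-- Percolation ⇒ triple: a vertex infected at a later time has three distinct infected vertices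
-- within distance 2; by induction on time they are initially infected unless a close triple has
-- already appeared, and three vertices within distance 2 of a common vertex are pairwise within
-- distance 4.
--
-- Triple ⇒ percolation: the eventually infected set P is closed under "three distinct members
-- within distance 2 of v force v".  If P has three distinct members within distance 1 of some c,
-- then P grows ball by ball around c, because a vertex v at distance ≥ 2 from c has three distinct
-- vertices within distance 2 that are closer to c: two successive steps from v toward c, and the
-- fourth corner of the square they span with v.  For a close triple, its coordinatewise median M
-- lies on a geodesic between any two of its points, so at most two of them are at distance ≥ 2
-- from M; at most two applications of the closure rule then give three members within distance 1
-- of a common vertex.

open import Defs
open import Data.Bool using (Bool; true; false; _∧_; _∨_; if_then_else_; T)
import Data.Bool.Properties as Bool
open import Data.Bool.Properties using (T?; T-∧; T-∨; T-≡; ∨-zeroʳ)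
open import Data.List using (List; []; _∷_; map; length)
open import Data.List.Membership.Propositional using (_∈_)
open import Data.List.Membership.Propositional.Properties
  using (∈-length; ∈-filter⁺; ∈-filter⁻; ∈-map⁺; ∈-map⁻; ∈-++⁺ˡ; ∈-++⁺ʳ)
open import Data.List.Relation.Unary.All as All using (All; []; _∷_)
open import Data.List.Relation.Unary.AllPairs using ([]; _∷_)
open import Data.List.Relation.Unary.Any using (here; there)
open import Data.List.Relation.Unary.Unique.Propositional using (Unique)
import Data.List.Relation.Unary.Unique.Propositional.Properties as Unique
open import Data.Nat
  using (ℕ; zero; suc; _+_; _≤_; _≤ᵇ_; _<_; _≤′_; ≤′-refl; ≤′-step; z≤n; s≤s; _≤?_; _≟_)
open import Data.Nat.Properties
open import Algebra.Properties.CommutativeSemigroup +-commutativeSemigroup using (interchange)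
open import Data.Product using (Σ; _×_; _,_; proj₁; proj₂)
open import Data.Sum using (_⊎_; inj₁; inj₂)
open import Data.Unit using (⊤)
open import Data.Vec using ([]; _∷_; replicate)
open import Data.Vec.Properties using (∷-injectiveʳ; ≡-dec)
open import Function using (_∘_)
open import Function.Bundles using (_⇔_; mk⇔; Equivalence)
open import Relation.Binary.Definitions using (DecidableEquality)
open import Relation.Binary.PropositionalEquality
open import Relation.Nullary using (¬_; yes; no; contradiction)

private
  variable
    n : ℕ

-- dH (a ∷ x) (b ∷ y) unfolds to bitDist a b + dH x y.
bitDist : Bool → Bool → ℕ
bitDist a b = if xorB a b then 1 else 0

_≟ᵥ_ : DecidableEquality (Vertex n)
_≟ᵥ_ = ≡-dec Bool._≟_

dH-refl : (x : Vertex n) → dH x x ≡ 0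
dH-refl []          = refl
dH-refl (false ∷ x) = dH-refl x
dH-refl (true ∷ x)  = dH-refl x

dH≡0⇒≡ : {x y : Vertex n} → dH x y ≡ 0 → x ≡ y
dH≡0⇒≡ {x = []}        {[]}        _ = refl
dH≡0⇒≡ {x = false ∷ x} {false ∷ y} e = cong (false ∷_) (dH≡0⇒≡ e)
dH≡0⇒≡ {x = true ∷ x}  {true ∷ y}  e = cong (true ∷_) (dH≡0⇒≡ e)

dH-pos⇒≢ : {x y : Vertex n} → 0 < dH x y → x ≢ y
dH-pos⇒≢ {x = x} pos refl = <⇒≢ pos (sym (dH-refl x))

≢⇒dH-pos : {x y : Vertex n} → x ≢ y → 0 < dH x y
≢⇒dH-pos x≢y = n≢0⇒n>0 (x≢y ∘ dH≡0⇒≡)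

bitDist-sym : ∀ a b → bitDist a b ≡ bitDist b a
bitDist-sym false false = refl
bitDist-sym false true  = refl
bitDist-sym true  false = refl
bitDist-sym true  true  = refl

dH-sym : (x y : Vertex n) → dH x y ≡ dH y x
dH-sym []      []      = refl
dH-sym (a ∷ x) (b ∷ y) = cong₂ _+_ (bitDist-sym a b) (dH-sym x y)

bitDist-triangle : ∀ a b c → bitDist a c ≤ bitDist a b + bitDist b c
bitDist-triangle false false false = z≤n
bitDist-triangle false false true  = s≤s z≤n
bitDist-triangle false true  false = z≤n
bitDist-triangle false true  true  = s≤s z≤n
bitDist-triangle true  false false = s≤s z≤n
bitDist-triangle true  false true  = z≤n
bitDist-triangle true  true  false = s≤s z≤n
bitDist-triangle true  true  true  = z≤n

dH-triangle : (x y z : Vertex n) → dH x z ≤ dH x y + dH y z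
dH-triangle []      []      []      = z≤n
dH-triangle (a ∷ x) (b ∷ y) (c ∷ z) = begin
  bitDist a c + dH x z
    ≤⟨ +-mono-≤ (bitDist-triangle a b c) (dH-triangle x y z) ⟩
  (bitDist a b + bitDist b c) + (dH x y + dH y z)
    ≡⟨ interchange (bitDist a b) (bitDist b c) (dH x y) (dH y z) ⟩
  (bitDist a b + dH x y) + (bitDist b c + dH y z)
    ∎
  where open ≤-Reasoning

dH-two-steps : (x y z : Vertex n) → dH x y ≤ 1 → dH y z ≤ 1 → dH x z ≤ 2
dH-two-steps x y z xy yz = ≤-trans (dH-triangle x y z) (+-mono-≤ xy yz)

stepToward : Vertex n → Vertex n → Vertex n
stepToward []      []      = []
stepToward (a ∷ x) (b ∷ y) = if xorB a b then b ∷ x else a ∷ stepToward x y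

dH-stepToward : (x y : Vertex n) → 0 < dH x y → dH x (stepToward x y) ≡ 1
dH-stepToward []          []          ()
dH-stepToward (false ∷ x) (false ∷ y) pos = dH-stepToward x y pos
dH-stepToward (false ∷ x) (true ∷ y)  _   = cong suc (dH-refl x)
dH-stepToward (true ∷ x)  (false ∷ y) _   = cong suc (dH-refl x)
dH-stepToward (true ∷ x)  (true ∷ y)  pos = dH-stepToward x y pos

stepToward-closer : (x y : Vertex n) → 0 < dH x y → suc (dH (stepToward x y) y) ≡ dH x y
stepToward-closer []          []          ()
stepToward-closer (false ∷ x) (false ∷ y) pos = stepToward-closer x y pos
stepToward-closer (false ∷ x) (true ∷ y)  _   = refl
stepToward-closer (true ∷ x)  (false ∷ y) _   = refl
stepToward-closer (true ∷ x)  (true ∷ y)  pos = stepToward-closer x y pos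

-- For unit steps x → y → z in two different coordinates, xor₃ x y z is the fourth corner of
-- the square they span.
xor₃ : Vertex n → Vertex n → Vertex n → Vertex n
xor₃ []      []      []      = []
xor₃ (a ∷ x) (b ∷ y) (c ∷ z) = xorB (xorB a b) c ∷ xor₃ x y z

dH-xor₃ : (x y z : Vertex n) →
  dH (xor₃ x y z) x ≡ dH y z × dH (xor₃ x y z) y ≡ dH x z × dH (xor₃ x y z) z ≡ dH x y
dH-xor₃ []      []      []      = refl , refl , refl
dH-xor₃ (a ∷ x) (b ∷ y) (c ∷ z) with bits a b c | dH-xor₃ x y z
  where
  bits : ∀ a b c → let d = xorB (xorB a b) c in
    bitDist d a ≡ bitDist b c × bitDist d b ≡ bitDist a c × bitDist d c ≡ bitDist a b
  bits false false false = refl , refl , refl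
  bits false false true  = refl , refl , refl
  bits false true  false = refl , refl , refl
  bits false true  true  = refl , refl , refl
  bits true  false false = refl , refl , refl
  bits true  false true  = refl , refl , refl
  bits true  true  false = refl , refl , refl
  bits true  true  true  = refl , refl , refl
... | e₁ , e₂ , e₃ | f₁ , f₂ , f₃ = cong₂ _+_ e₁ f₁ , cong₂ _+_ e₂ f₂ , cong₂ _+_ e₃ f₃

Between : Vertex n → Vertex n → Vertex n → Set
Between m x y = dH m x + dH m y ≡ dH x y

majority : Bool → Bool → Bool → Bool
majority a b c = (a ∧ b) ∨ ((a ∧ c) ∨ (b ∧ c))

median : Vertex n → Vertex n → Vertex n → Vertex n
median []      []      []      = []
median (a ∷ x) (b ∷ y) (c ∷ z) = majority a b c ∷ median x y z

between-∷ : ∀ m a b (M x y : Vertex n) → bitDist m a + bitDist m b ≡ bitDist a b →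
  Between M x y → Between (m ∷ M) (a ∷ x) (b ∷ y)
between-∷ m a b M x y bit rest = begin
  (bitDist m a + dH M x) + (bitDist m b + dH M y)
    ≡⟨ interchange (bitDist m a) (dH M x) (bitDist m b) (dH M y) ⟩
  (bitDist m a + bitDist m b) + (dH M x + dH M y)
    ≡⟨ cong₂ _+_ bit rest ⟩
  bitDist a b + dH x y
    ∎
  where open ≡-Reasoning

median-between : (x y z : Vertex n) → let m = median x y z in
  Between m x y × Between m x z × Between m y z
median-between []      []      []      = refl , refl , refl
median-between (a ∷ x) (b ∷ y) (c ∷ z) with bits a b c | median-between x y z
  where
  bits : ∀ a b c → let m = majority a b c in
    bitDist m a + bitDist m b ≡ bitDist a b ×
    bitDist m a + bitDist m c ≡ bitDist a c ×
    bitDist m b + bitDist m c ≡ bitDist b c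
  bits false false false = refl , refl , refl
  bits false false true  = refl , refl , refl
  bits false true  false = refl , refl , refl
  bits false true  true  = refl , refl , refl
  bits true  false false = refl , refl , refl
  bits true  false true  = refl , refl , refl
  bits true  true  false = refl , refl , refl
  bits true  true  true  = refl , refl , refl
... | e₁ , e₂ , e₃ | f₁ , f₂ , f₃ =
  between-∷ m a b M x y e₁ f₁ , between-∷ m a c M x z e₂ f₂ , between-∷ m b c M y z e₃ f₃
  where
  m = majority a b c
  M = median x y z

record Three {X : Set} (Q : X → Set) : Set where
  constructor three
  field
    {u₁ u₂ u₃} : X
    u₁≢u₂ : u₁ ≢ u₂
    u₁≢u₃ : u₁ ≢ u₃
    u₂≢u₃ : u₂ ≢ u₃
    Q₁ : Q u₁
    Q₂ : Q u₂
    Q₃ : Q u₃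

three-map : {X : Set} {Q R : X → Set} → (∀ {u} → Q u → R u) → Three Q → Three R
three-map f (three u₁≢u₂ u₁≢u₃ u₂≢u₃ q₁ q₂ q₃) = three u₁≢u₂ u₁≢u₃ u₂≢u₃ (f q₁) (f q₂) (f q₃)

CloseTriple : (Vertex n → Set) → Set
CloseTriple {n} Q = Σ (Vertex n) (λ x₁ → Σ (Vertex n) (λ x₂ → Σ (Vertex n) (λ x₃ →
  Q x₁ × Q x₂ × Q x₃ × (x₁ ≢ x₂) × (x₁ ≢ x₃) × (x₂ ≢ x₃) ×
  (dH x₁ x₂ ≤ 4) × (dH x₁ x₃ ≤ 4) × (dH x₂ x₃ ≤ 4))))

closeTriple-map : {Q R : Vertex n → Set} → (∀ {u} → Q u → R u) → CloseTriple Q → CloseTriple R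
closeTriple-map f (x , y , z , Qx , Qy , Qz , rest) = x , y , z , f Qx , f Qy , f Qz , rest

closeTriple-join : {Q : Vertex n → Set} → CloseTriple (λ u → Q u ⊎ CloseTriple Q) → CloseTriple Q
closeTriple-join (_ , _ , _ , inj₂ c , _ , _ , _) = c
closeTriple-join (_ , _ , _ , _ , inj₂ c , _ , _) = c
closeTriple-join (_ , _ , _ , _ , _ , inj₂ c , _) = c
closeTriple-join (x , y , z , inj₁ Qx , inj₁ Qy , inj₁ Qz , rest) = x , y , z , Qx , Qy , Qz , rest

three-around⇒closeTriple : {Q : Vertex n → Set} (v : Vertex n) →
  Three (λ u → Q u × dH v u ≤ 2) → CloseTriple Q
three-around⇒closeTriple v (three {x} {y} {z} x≢y x≢z y≢z (Qx , vx) (Qy , vy) (Qz , vz)) =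
  x , y , z , Qx , Qy , Qz , x≢y , x≢z , y≢z , via vx vy , via vx vz , via vy vz
  where
  via : ∀ {u w} → dH v u ≤ 2 → dH v w ≤ 2 → dH u w ≤ 4
  via {u} {w} vu vw = ≤-trans (dH-triangle u v w) (+-mono-≤ (subst (_≤ 2) (dH-sym v u) vu) vw)

cube-closeTriple : 2 ≤ n → CloseTriple {n} (λ _ → ⊤)
cube-closeTriple {suc zero} (s≤s ())
cube-closeTriple {suc (suc k)} _ =
  o , e₁ , e₂ , _ , _ , _ , (λ ()) , (λ ()) , (λ ()) , s≤s oo , s≤s oo , s≤s (s≤s oo)
  where
  zeros = replicate k false
  o e₁ e₂ : Vertex (suc (suc k))
  o  = false ∷ false ∷ zeros
  e₁ = true  ∷ false ∷ zeros
  e₂ = false ∷ true  ∷ zeros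
  oo : ∀ {m} → dH zeros zeros ≤ m
  oo = ≤-trans (≤-reflexive (dH-refl zeros)) z≤n

-- Closure under the 3-neighbour rule, stated with dH v u ≤ 2 instead of adjacency: the extra
-- case, where v is one of the three, holds trivially.
Closed : (Vertex n → Set) → Set
Closed {n} P = (v : Vertex n) → Three (λ u → P u × dH v u ≤ 2) → P v

three-steps-toward : (v c : Vertex n) → 2 ≤ dH v c → Three (λ w → dH v w ≤ 2 × dH w c < dH v c)
three-steps-toward v c vc≥2 =
  three w₁≢w₂ (≢-sym w₃≢w₁) (≢-sym w₃≢w₂)
    (≤-trans (≤-reflexive vw₁) (s≤s z≤n) , w₁c<vc)
    (dH-two-steps v w₁ w₂ (≤-reflexive vw₁) (≤-reflexive w₁w₂) , <-trans w₂c<w₁c w₁c<vc)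
    (≤-trans (≤-reflexive (trans (dH-sym v w₃) w₃v)) (s≤s z≤n) , w₃c<vc)
  where
  w₁ = stepToward v c
  w₂ = stepToward w₁ c
  w₃ = xor₃ v w₁ w₂
  vc>0 : 0 < dH v c
  vc>0 = ≤-trans (s≤s z≤n) vc≥2
  vw₁ : dH v w₁ ≡ 1
  vw₁ = dH-stepToward v c vc>0
  w₁c<vc : dH w₁ c < dH v c
  w₁c<vc = ≤-reflexive (stepToward-closer v c vc>0)
  w₁c>0 : 0 < dH w₁ c
  w₁c>0 = ≤-pred (≤-trans vc≥2 (≤-reflexive (sym (stepToward-closer v c vc>0))))
  w₁w₂ : dH w₁ w₂ ≡ 1
  w₁w₂ = dH-stepToward w₁ c w₁c>0
  w₂c<w₁c : dH w₂ c < dH w₁ c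
  w₂c<w₁c = ≤-reflexive (stepToward-closer w₁ c w₁c>0)
  w₃v : dH w₃ v ≡ 1
  w₃v = trans (proj₁ (dH-xor₃ v w₁ w₂)) w₁w₂
  w₃w₂ : dH w₃ w₂ ≡ 1
  w₃w₂ = trans (proj₂ (proj₂ (dH-xor₃ v w₁ w₂))) vw₁
  w₃c<vc : dH w₃ c < dH v c
  w₃c<vc = begin-strict
    dH w₃ c            ≤⟨ dH-triangle w₃ w₂ c ⟩
    dH w₃ w₂ + dH w₂ c ≡⟨ cong (_+ dH w₂ c) w₃w₂ ⟩
    suc (dH w₂ c)      ≤⟨ w₂c<w₁c ⟩
    dH w₁ c            <⟨ w₁c<vc ⟩
    dH v c             ∎
    where open ≤-Reasoning
  w₁≢w₂ : w₁ ≢ w₂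
  w₁≢w₂ = dH-pos⇒≢ (≤-reflexive (sym w₁w₂))
  w₃≢w₂ : w₃ ≢ w₂
  w₃≢w₂ = dH-pos⇒≢ (≤-reflexive (sym w₃w₂))
  w₃≢w₁ : w₃ ≢ w₁
  w₃≢w₁ = dH-pos⇒≢ (subst (0 <_) (sym (proj₁ (proj₂ (dH-xor₃ v w₁ w₂)))) (≢⇒dH-pos v≢w₂))
    where
    v≢w₂ : v ≢ w₂
    v≢w₂ v≡w₂ = <-irrefl (cong (λ u → dH u c) (sym v≡w₂)) (<-trans w₂c<w₁c w₁c<vc)

sum≤4⇒≤3 : ∀ {m k} → m + k ≤ 4 → 0 < k → m ≤ 3
sum≤4⇒≤3 {m} m+k≤4 k>0 = ≤-pred (subst (_≤ 4) (+-comm m 1) (≤-trans (+-monoʳ-≤ m k>0) m+k≤4))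

sum≤4⇒≤2 : ∀ {m k} → m + k ≤ 4 → 2 ≤ m → k ≤ 2
sum≤4⇒≤2 {m} {k} m+k≤4 m≥2 = +-cancelˡ-≤ 2 k 2 (≤-trans (+-monoˡ-≤ k m≥2) m+k≤4)

record ShortBetween (M x y : Vertex n) : Set where
  constructor shortBetween
  field
    between : Between M x y
    bounded : dH x y ≤ 4

shortBetween-sym : {M x y : Vertex n} → ShortBetween M x y → ShortBetween M y x
shortBetween-sym {M = M} {x} {y} (shortBetween between xy≤4) = shortBetween
  (trans (+-comm (dH M y) (dH M x)) (trans between (dH-sym x y))) (subst (_≤ 4) (dH-sym x y) xy≤4)

shortBetween-sum≤4 : {M x y : Vertex n} → ShortBetween M x y → dH M x + dH M y ≤ 4
shortBetween-sum≤4 (shortBetween between xy≤4) = ≤-trans (≤-reflexive between) xy≤4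

module _ {P : Vertex n → Set} (closed : Closed P) where

  clustered⇒everywhere : (c : Vertex n) → Three (λ u → P u × dH c u ≤ 1) → ∀ v → P v
  clustered⇒everywhere c cluster v = within (dH v c) v ≤-refl
    where
    near : ∀ v → dH v c ≤ 1 → P v
    near v vc≤1 = closed v (three-map (λ {u} (Pu , cu≤1) → Pu , dH-two-steps v c u vc≤1 cu≤1) cluster)
    within : ∀ r v → dH v c ≤ r → P v
    within r v vc≤r with dH v c ≤? 1
    ... | yes vc≤1 = near v vc≤1
    within zero    v vc≤0 | no vc≰1 = contradiction (≤-trans vc≤0 z≤n) vc≰1
    within (suc r) v vc≤r | no vc≰1 =
      closed v (three-map (λ {w} (vw≤2 , wc<vc) → within r w (≤-pred (≤-trans wc<vc vc≤r)) , vw≤2)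
                          (three-steps-toward v c (≰⇒> vc≰1)))

  one-far⇒everywhere : (M x y z : Vertex n) → P x → P y → P z → x ≢ y → x ≢ z → y ≢ z →
    ShortBetween M x y → ShortBetween M x z → 2 ≤ dH M x → dH M y ≤ 1 → dH M z ≤ 1 → ∀ v → P v
  one-far⇒everywhere M x y z Px Py Pz x≢y x≢z y≢z sxy sxz Mx≥2 My≤1 Mz≤1 =
    clustered⇒everywhere M (three (nearer≢ sxy) (nearer≢ sxz) y≢z
      (Pt , ≤-reflexive Mt) (Py , My≤1) (Pz , Mz≤1))
    where
    t = stepToward M x
    Mx>0 : 0 < dH M x
    Mx>0 = ≤-trans (s≤s z≤n) Mx≥2
    Mt : dH M t ≡ 1
    Mt = dH-stepToward M x Mx>0
    tx<Mx : dH t x < dH M x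
    tx<Mx = ≤-reflexive (stepToward-closer M x Mx>0)
    Mx≤3 : dH M x ≤ 3
    Mx≤3 with dH M y ≟ 0
    ... | no  My≢0 = sum≤4⇒≤3 (shortBetween-sum≤4 sxy) (n≢0⇒n>0 My≢0)
    ... | yes My≡0 = sum≤4⇒≤3 (shortBetween-sum≤4 sxz) (≢⇒dH-pos M≢z)
      where
      M≢z : M ≢ z
      M≢z M≡z = y≢z (trans (sym (dH≡0⇒≡ My≡0)) M≡z)
    tM≤1 : dH t M ≤ 1
    tM≤1 = ≤-reflexive (trans (dH-sym t M) Mt)
    Pt : P t
    Pt = closed t (three x≢y x≢z y≢z
      (Px , ≤-pred (≤-trans tx<Mx Mx≤3))
      (Py , dH-two-steps t M y tM≤1 My≤1)
      (Pz , dH-two-steps t M z tM≤1 Mz≤1))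
    nearer≢ : ∀ {w} → ShortBetween M x w → t ≢ w
    nearer≢ {w} (shortBetween between _) t≡w = <-irrefl refl (begin-strict
      dH w x             ≡⟨ cong (λ u → dH u x) (sym t≡w) ⟩
      dH t x             <⟨ tx<Mx ⟩
      dH M x             ≤⟨ m≤m+n (dH M x) (dH M w) ⟩
      dH M x + dH M w    ≡⟨ trans between (dH-sym x w) ⟩
      dH w x             ∎)
      where open ≤-Reasoning

  -- Here dH x y = 4.  The closure rule gives M, then the fourth corner j of the square x', M, y',
  -- and x, M, j lie within distance 1 of x'.
  two-far⇒everywhere : (M x y z : Vertex n) → P x → P y → P z → x ≢ y → x ≢ z → y ≢ z →
    ShortBetween M x y → ShortBetween M x z → 2 ≤ dH M x → 2 ≤ dH M y → ∀ v → P v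
  two-far⇒everywhere M x y z Px Py Pz x≢y x≢z y≢z sxy sxz Mx≥2 My≥2 =
    clustered⇒everywhere x' (three x≢M x≢j M≢j (Px , x'x≤1) (PM , x'M≤1) (Pj , x'j≤1))
    where
    Mx>0 : 0 < dH M x
    Mx>0 = ≤-trans (s≤s z≤n) Mx≥2
    My>0 : 0 < dH M y
    My>0 = ≤-trans (s≤s z≤n) My≥2
    Mx≤2 : dH M x ≤ 2
    Mx≤2 = sum≤4⇒≤2 (subst (_≤ 4) (+-comm (dH M x) (dH M y)) (shortBetween-sum≤4 sxy)) My≥2
    My≤2 : dH M y ≤ 2
    My≤2 = sum≤4⇒≤2 (shortBetween-sum≤4 sxy) Mx≥2
    Mz≤2 : dH M z ≤ 2
    Mz≤2 = sum≤4⇒≤2 (shortBetween-sum≤4 sxz) Mx≥2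
    xy≰2 : ¬ dH x y ≤ 2
    xy≰2 xy≤2
      with ≤-trans (+-mono-≤ Mx≥2 My≥2) (≤-trans (≤-reflexive (ShortBetween.between sxy)) xy≤2)
    ... | s≤s (s≤s ())
    x≢M : x ≢ M
    x≢M = ≢-sym (dH-pos⇒≢ Mx>0)
    y≢M : y ≢ M
    y≢M = ≢-sym (dH-pos⇒≢ My>0)
    PM : P M
    PM = closed M (three x≢y x≢z y≢z (Px , Mx≤2) (Py , My≤2) (Pz , Mz≤2))
    x' = stepToward M x
    y' = stepToward M y
    Mx' : dH M x' ≡ 1
    Mx' = dH-stepToward M x Mx>0
    My' : dH M y' ≡ 1
    My' = dH-stepToward M y My>0
    x'M≤1 : dH x' M ≤ 1
    x'M≤1 = ≤-reflexive (trans (dH-sym x' M) Mx')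
    x'x≤1 : dH x' x ≤ 1
    x'x≤1 = ≤-pred (≤-trans (≤-reflexive (stepToward-closer M x Mx>0)) Mx≤2)
    y'y≤1 : dH y' y ≤ 1
    y'y≤1 = ≤-pred (≤-trans (≤-reflexive (stepToward-closer M y My>0)) My≤2)
    j = xor₃ x' M y'
    jx' : dH j x' ≡ 1
    jx' = trans (proj₁ (dH-xor₃ x' M y')) My'
    jM : dH j M ≡ dH x' y'
    jM = proj₁ (proj₂ (dH-xor₃ x' M y'))
    jy' : dH j y' ≡ 1
    jy' = trans (proj₂ (proj₂ (dH-xor₃ x' M y'))) (trans (dH-sym x' M) Mx')
    x'j≤1 : dH x' j ≤ 1
    x'j≤1 = ≤-reflexive (trans (dH-sym x' j) jx')
    jy≤2 : dH j y ≤ 2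
    jy≤2 = dH-two-steps j y' y (≤-reflexive jy') y'y≤1
    Pj : P j
    Pj = closed j (three x≢y x≢M y≢M
      (Px , dH-two-steps j x' x (≤-reflexive jx') x'x≤1)
      (Py , jy≤2)
      (PM , ≤-trans (≤-reflexive jM) (dH-two-steps x' M y' x'M≤1 (≤-reflexive My'))))
    x≢j : x ≢ j
    x≢j x≡j = xy≰2 (subst (λ u → dH u y ≤ 2) (sym x≡j) jy≤2)
    M≢j : M ≢ j
    M≢j M≡j = xy≰2 (dH-two-steps x x' y (subst (_≤ 1) (dH-sym x' x) x'x≤1)
                                       (subst (λ u → dH u y ≤ 1) (sym x'≡y') y'y≤1))
      where
      x'≡y' : x' ≡ y'
      x'≡y' = dH≡0⇒≡ (trans (sym jM) (trans (cong (dH j) M≡j) (dH-refl j)))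

  closeTriple⇒everywhere : CloseTriple P → ∀ v → P v
  closeTriple⇒everywhere (x , y , z , Px , Py , Pz , x≢y , x≢z , y≢z , xy≤4 , xz≤4 , yz≤4) =
    let Bxy , Bxz , Byz = median-between x y z
    in around (median x y z)
         (shortBetween Bxy xy≤4) (shortBetween Bxz xz≤4) (shortBetween Byz yz≤4)
    where
    around : ∀ M → ShortBetween M x y → ShortBetween M x z → ShortBetween M y z → ∀ v → P v
    around M xy xz yz with dH M x ≤? 1 | dH M y ≤? 1 | dH M z ≤? 1
    ... | yes Mx≤1 | yes My≤1 | yes Mz≤1 =
      clustered⇒everywhere M (three x≢y x≢z y≢z (Px , Mx≤1) (Py , My≤1) (Pz , Mz≤1))
    ... | no Mx≰1 | yes My≤1 | yes Mz≤1 =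
      one-far⇒everywhere M x y z Px Py Pz x≢y x≢z y≢z xy xz (≰⇒> Mx≰1) My≤1 Mz≤1
    ... | yes Mx≤1 | no My≰1 | yes Mz≤1 =
      one-far⇒everywhere M y x z Py Px Pz (≢-sym x≢y) y≢z x≢z (shortBetween-sym xy) yz
        (≰⇒> My≰1) Mx≤1 Mz≤1
    ... | yes Mx≤1 | yes My≤1 | no Mz≰1 =
      one-far⇒everywhere M z x y Pz Px Py (≢-sym x≢z) (≢-sym y≢z) x≢y
        (shortBetween-sym xz) (shortBetween-sym yz) (≰⇒> Mz≰1) Mx≤1 My≤1
    ... | no Mx≰1 | no My≰1 | _ =
      two-far⇒everywhere M x y z Px Py Pz x≢y x≢z y≢z xy xz (≰⇒> Mx≰1) (≰⇒> My≰1)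
    ... | no Mx≰1 | yes _ | no Mz≰1 =
      two-far⇒everywhere M x z y Px Pz Py x≢z x≢y (≢-sym y≢z) xz xy (≰⇒> Mx≰1) (≰⇒> Mz≰1)
    ... | yes _ | no My≰1 | no Mz≰1 =
      two-far⇒everywhere M y z x Py Pz Px y≢z (≢-sym x≢y) (≢-sym x≢z) yz (shortBetween-sym xy)
        (≰⇒> My≰1) (≰⇒> Mz≰1)

module _ {X : Set} where

  distinct-members⇒2≤length : {xs : List X} {u w : X} → u ∈ xs → w ∈ xs → u ≢ w → 2 ≤ length xs
  distinct-members⇒2≤length (here refl) (here refl) u≢w = contradiction refl u≢w
  distinct-members⇒2≤length (here _)    (there w∈) _   = s≤s (∈-length w∈)
  distinct-members⇒2≤length (there u∈)  (here _)   _   = s≤s (∈-length u∈)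
  distinct-members⇒2≤length (there u∈)  (there w∈) u≢w =
    m≤n⇒m≤1+n (distinct-members⇒2≤length u∈ w∈ u≢w)

  three-members⇒3≤length : {xs : List X} → Three (_∈ xs) → 3 ≤ length xs
  three-members⇒3≤length (three u₁≢u₂ _ _ (here refl) (here refl) _) = contradiction refl u₁≢u₂
  three-members⇒3≤length (three _ u₁≢u₃ _ (here refl) _ (here refl)) = contradiction refl u₁≢u₃
  three-members⇒3≤length (three _ _ u₂≢u₃ _ (here refl) (here refl)) = contradiction refl u₂≢u₃
  three-members⇒3≤length (three _ _ u₂≢u₃ (here _) (there ∈₂) (there ∈₃)) =
    s≤s (distinct-members⇒2≤length ∈₂ ∈₃ u₂≢u₃)
  three-members⇒3≤length (three _ u₁≢u₃ _ (there ∈₁) (here _) (there ∈₃)) =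
    s≤s (distinct-members⇒2≤length ∈₁ ∈₃ u₁≢u₃)
  three-members⇒3≤length (three u₁≢u₂ _ _ (there ∈₁) (there ∈₂) (here _)) =
    s≤s (distinct-members⇒2≤length ∈₁ ∈₂ u₁≢u₂)
  three-members⇒3≤length (three u₁≢u₂ u₁≢u₃ u₂≢u₃ (there ∈₁) (there ∈₂) (there ∈₃)) =
    m≤n⇒m≤1+n (three-members⇒3≤length (three u₁≢u₂ u₁≢u₃ u₂≢u₃ ∈₁ ∈₂ ∈₃))

  unique⇒three-members : (xs : List X) → Unique xs → 3 ≤ length xs → Three (_∈ xs)
  unique⇒three-members (_ ∷ [])     _ (s≤s ())
  unique⇒three-members (_ ∷ _ ∷ []) _ (s≤s (s≤s ()))
  unique⇒three-members (_ ∷ _ ∷ _ ∷ _) ((u₁≢u₂ ∷ u₁≢u₃ ∷ _) ∷ (u₂≢u₃ ∷ _) ∷ _) _ =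
    three u₁≢u₂ u₁≢u₃ u₂≢u₃ (here refl) (there (here refl)) (there (there (here refl)))

∈-allVertices : (v : Vertex n) → v ∈ allVertices n
∈-allVertices []          = here refl
∈-allVertices (false ∷ v) = ∈-++⁺ˡ (∈-map⁺ (false ∷_) (∈-allVertices v))
∈-allVertices (true ∷ v)  = ∈-++⁺ʳ _ (∈-map⁺ (true ∷_) (∈-allVertices v))

allVertices-unique : ∀ n → Unique (allVertices n)
allVertices-unique zero    = [] ∷ []
allVertices-unique (suc n) = Unique.++⁺ (Unique.map⁺ ∷-injectiveʳ (allVertices-unique n))
                                        (Unique.map⁺ ∷-injectiveʳ (allVertices-unique n))
                                        false≢true
  where
  false≢true : ∀ {v} → ¬ (v ∈ map (false ∷_) (allVertices n) × v ∈ map (true ∷_) (allVertices n))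
  false≢true (v∈₀ , v∈₁) with ∈-map⁻ (false ∷_) v∈₀ | ∈-map⁻ (true ∷_) v∈₁
  ... | _ , _ , refl | _ , _ , ()

record NeighbourIn (S : VSet n) (v u : Vertex n) : Set where
  constructor neighbourIn
  field
    adjacent∧member : T (adjB v u ∧ S u)

three⇒3≤nbCount : (S : VSet n) (v : Vertex n) → Three (NeighbourIn S v) → 3 ≤ nbCount S v
three⇒3≤nbCount S v = three-members⇒3≤length ∘ three-map (λ {u} (neighbourIn q) →
  ∈-filter⁺ (λ u → T? (adjB v u ∧ S u)) (∈-allVertices u) q)

3≤nbCount⇒three : (S : VSet n) (v : Vertex n) → 3 ≤ nbCount S v → Three (NeighbourIn S v)
3≤nbCount⇒three {n} S v =
  three-map (neighbourIn ∘ proj₂ ∘ ∈-filter⁻ neighbour? {xs = allVertices n})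
  ∘ unique⇒three-members _ (Unique.filter⁺ neighbour? (allVertices-unique n))
  where
  neighbour? = λ u → T? (adjB v u ∧ S u)

neighbourIn⇒ : {S : VSet n} {v u : Vertex n} → NeighbourIn S v u → S u ≡ true × dH v u ≤ 2
neighbourIn⇒ {v = v} {u} (neighbourIn q) =
  let adjacent , member = Equivalence.to T-∧ q
  in Equivalence.to T-≡ member , ≤ᵇ⇒≤ (dH v u) 2 (proj₂ (Equivalence.to T-∧ adjacent))

neighbourIn⇐ : {S : VSet n} {v u : Vertex n} →
  S u ≡ true → 0 < dH v u → dH v u ≤ 2 → NeighbourIn S v u
neighbourIn⇐ Su vu>0 vu≤2 = neighbourIn
  (Equivalence.from T-∧ (Equivalence.from T-∧ (≤⇒≤ᵇ vu>0 , ≤⇒≤ᵇ vu≤2) , Equivalence.from T-≡ Su))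

module Process (r : ℕ) (A : VSet n) where

  Infected : ℕ → Vertex n → Set
  Infected t v = infected r A t v ≡ true

  Eventually : Vertex n → Set
  Eventually v = Σ ℕ (λ t → Infected t v)

  infected-mono : ∀ {t s} v → t ≤ s → Infected t v → Infected s v
  infected-mono v = go ∘ ≤⇒≤′
    where
    go : ∀ {t s} → t ≤′ s → Infected t v → Infected s v
    go ≤′-refl       i = i
    go {s = suc s} (≤′-step t≤s) i = cong (_∨ (r ≤ᵇ nbCount (infected r A s) v)) (go t≤s i)

  newly-infected : ∀ t v → r ≤ nbCount (infected r A t) v → Infected (suc t) v
  newly-infected t v r≤count =
    trans (cong (infected r A t v ∨_) (Equivalence.to T-≡ (≤⇒≤ᵇ r≤count))) (∨-zeroʳ _)

  simultaneously : (vs : List (Vertex n)) → All Eventually vs → Σ ℕ (λ t → All (Infected t) vs)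
  simultaneously []       []             = 0 , []
  simultaneously (v ∷ vs) ((t , i) ∷ es) =
    let s , is = simultaneously vs es
    in t + s , infected-mono v (m≤m+n t s) i ∷ All.map (λ {u} → infected-mono u (m≤n+m s t)) is

  everywhere⇒percolates : (∀ v → Eventually v) → Percolates r A
  everywhere⇒percolates eventually =
    let t , all = simultaneously (allVertices n) (All.tabulate (λ {v} _ → eventually v))
    in t , λ v → All.lookup all (∈-allVertices v)

module ThreeNeighbour (A : VSet n) where

  open Process 3 A

  eventually-closed : Closed Eventually
  eventually-closed v (three {u₁} {u₂} {u₃} u₁≢u₂ u₁≢u₃ u₂≢u₃ (e₁ , vu₁≤2) (e₂ , vu₂≤2) (e₃ , vu₃≤2))
    with v ≟ᵥ u₁ | v ≟ᵥ u₂ | v ≟ᵥ u₃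
  ... | yes refl | _        | _        = e₁
  ... | no _     | yes refl | _        = e₂
  ... | no _     | no _     | yes refl = e₃
  ... | no v≢u₁  | no v≢u₂  | no v≢u₃
    with simultaneously (u₁ ∷ u₂ ∷ u₃ ∷ []) (e₁ ∷ e₂ ∷ e₃ ∷ [])
  ...   | t , i₁ ∷ i₂ ∷ i₃ ∷ [] = suc t , newly-infected t v (three⇒3≤nbCount _ v
          (three u₁≢u₂ u₁≢u₃ u₂≢u₃ (neighbourIn⇐ i₁ (≢⇒dH-pos v≢u₁) vu₁≤2)
                                   (neighbourIn⇐ i₂ (≢⇒dH-pos v≢u₂) vu₂≤2)
                                   (neighbourIn⇐ i₃ (≢⇒dH-pos v≢u₃) vu₃≤2)))

  closeTriple⇒percolates : CloseTriple (λ u → A u ≡ true) → Percolates 3 A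
  closeTriple⇒percolates =
    everywhere⇒percolates ∘ closeTriple⇒everywhere eventually-closed ∘ closeTriple-map (0 ,_)

  infected⇒seed⊎closeTriple : ∀ t v → Infected t v → A v ≡ true ⊎ CloseTriple (λ u → A u ≡ true)
  infected⇒seed⊎closeTriple zero    v i = inj₁ i
  infected⇒seed⊎closeTriple (suc t) v i with Equivalence.to T-∨ (Equivalence.from T-≡ i)
  ... | inj₁ earlier = infected⇒seed⊎closeTriple t v (Equivalence.to T-≡ earlier)
  ... | inj₂ 3≤count = inj₂ (closeTriple-join (three-around⇒closeTriple v
          (three-map (λ {u} nb → let i , vu≤2 = neighbourIn⇒ nb
                                 in infected⇒seed⊎closeTriple t u i , vu≤2)
                     (3≤nbCount⇒three _ v (≤ᵇ⇒≤ 3 _ 3≤count)))))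

  percolates⇒closeTriple : CloseTriple {n} (λ _ → ⊤) → Percolates 3 A →
    CloseTriple (λ u → A u ≡ true)
  percolates⇒closeTriple cube (t , all) =
    closeTriple-join (closeTriple-map (λ {v} _ → infected⇒seed⊎closeTriple t v (all v)) cube)

lemma3p1 : (n : ℕ) → 2 ≤ n → (A₀ : VSet n) →
    Percolates 3 A₀ ⇔
    Σ (Vertex n) (λ x₁ → Σ (Vertex n) (λ x₂ → Σ (Vertex n) (λ x₃ →
      (A₀ x₁ ≡ true) × (A₀ x₂ ≡ true) × (A₀ x₃ ≡ true) ×
      (x₁ ≢ x₂) × (x₁ ≢ x₃) × (x₂ ≢ x₃) ×
      (dH x₁ x₂ ≤ 4) × (dH x₁ x₃ ≤ 4) × (dH x₂ x₃ ≤ 4))))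
lemma3p1 n 2≤n A₀ = mk⇔ (percolates⇒closeTriple (cube-closeTriple 2≤n)) closeTriple⇒percolates
  where open ThreeNeighbour A₀
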